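{- Let $\alpha\in[2/3,1)$, $k\ge1$ an integer, $G$ a graph and $S\subseteq V(G)$ a $(3k+1,\alpha)$-well-linked set. If $F\subseteq V(G)$ is $S$-free with $|F|=3k$, then $\mathcal{T}_F:=\{(A,B): (A,B)\text{ a separation of }G\text{ of order less than }k,\ |B\cap F|>2k\}$ is a tangle of order $k$ in $G$ which is a truncation of $\mathcal{T}_S$, i.e. $\mathcal{T}_F\subseteq\mathcal{T}_S$.
   Context: All graphs are finite, simple, undirected. A separation of $G$ is a pair $(A,B)$ with $A\cup B=V(G)$ and no edge between $A\setminus B$ and $B\setminus A$; its order is $|A\cap B|$. A tangle of order $k$ in $G$ is a set $\mathcal{T}$ of separations of order less than $k$ containing exactly one of $(A,B),(B,A)$ for every separation $(A,B)$ of order less than $k$, such that $A_1\cup A_2\cup A_3\neq V(G)$ for all $(A_1,B_1),(A_2,B_2),(A_3,B_3)\in\mathcal{T}$. For $S\subseteq V(G)$ and $\alpha\in[2/3,1)$, $X$ is an $\alpha$-balanced separator for $S$ if every component $C$ of $G-X$ has $|V(C)\cap S|\le\alpha|S|$; $S$ is $(q,\alpha)$-well-linked if no $\alpha$-balanced separator for $S$ has size at most $q$; for such $S$, $\mathcal{T}_S$ is the set of separations $(A,B)$ of order at most $q$ with $|S\cap B|>\alpha|S|$. A set $F$ is $S$-free if for every separation $(A_1,A_2)$ of order less than $|F|$ and every $i\in\{1,2\}$, $F\subseteq A_i$ implies $|A_i\cap S|>\alpha|S|$.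
   Formalization: The parameter α is a rational number in $[2/3,1)$ rather than a real one. -}

module Defs where

open import Data.Nat using (ℕ; suc; _+_; _*_) renaming (_≤_ to _≤ℕ_; _<_ to _<ℕ_)
open import Data.Fin using (Fin)
open import Data.Fin.Subset using (Subset; _∈_; _∉_; _⊆_; _∩_; _∪_; ∣_∣)
open import Data.Integer using (+_)
open import Data.Rational using (ℚ; _/_; _≤_; _<_) renaming (_*_ to _*ℚ_)
open import Data.Product using (Σ; _×_; ∃)
open import Data.Sum using (_⊎_)
open import Data.Empty using (⊥)
open import Relation.Nullary using (¬_)
open import Relation.Binary.PropositionalEquality using (_≡_)

ℕ→ℚ : ℕ → ℚ
ℕ→ℚ m = + m / 1

record Graph : Set₁ where
  field
    n     : ℕ
    Adj   : Fin n → Fin n → Set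
    sym   : ∀ {u v} → Adj u v → Adj v u
    irrefl : ∀ {u} → ¬ Adj u u
open Graph public

module _ (G : Graph) where
  private
    V = Fin (n G)

  IsSeparation : Subset (n G) → Subset (n G) → Set
  IsSeparation A B =
    (∀ v → v ∈ A ⊎ v ∈ B) ×
    (∀ u v → u ∈ A → u ∉ B → v ∈ B → v ∉ A → ¬ Adj G u v)

  order : Subset (n G) → Subset (n G) → ℕ
  order A B = ∣ A ∩ B ∣

  data Reach (X : Subset (n G)) : V → V → Set where
    here : ∀ {u} → u ∉ X → Reach X u u
    step : ∀ {u v w} → u ∉ X → Adj G u v → Reach X v w → Reach X u w

  IsComponent : Subset (n G) → Subset (n G) → Set
  IsComponent X C = Σ V λ u → u ∉ X × (∀ v → (v ∈ C → Reach X u v) × (Reach X u v → v ∈ C))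

  Balanced : ℚ → Subset (n G) → Subset (n G) → Set
  Balanced α S X = ∀ C → IsComponent X C → ℕ→ℚ ∣ C ∩ S ∣ ≤ α *ℚ ℕ→ℚ ∣ S ∣

  WellLinked : ℕ → ℚ → Subset (n G) → Set
  WellLinked q α S = ¬ (Σ (Subset (n G)) λ X → ∣ X ∣ ≤ℕ q × Balanced α S X)

  𝒯 : ℕ → ℚ → Subset (n G) → Subset (n G) → Subset (n G) → Set
  𝒯 q α S A B = IsSeparation A B × order A B ≤ℕ q × α *ℚ ℕ→ℚ ∣ S ∣ < ℕ→ℚ ∣ S ∩ B ∣

  Free : ℚ → Subset (n G) → Subset (n G) → Set
  Free α S F = ∀ A₁ A₂ → IsSeparation A₁ A₂ → order A₁ A₂ <ℕ ∣ F ∣ →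
    (F ⊆ A₁ → α *ℚ ℕ→ℚ ∣ S ∣ < ℕ→ℚ ∣ A₁ ∩ S ∣) ×
    (F ⊆ A₂ → α *ℚ ℕ→ℚ ∣ S ∣ < ℕ→ℚ ∣ A₂ ∩ S ∣)

  IsTangle : ℕ → (Subset (n G) → Subset (n G) → Set) → Set
  IsTangle k T =
    (∀ A B → T A B → IsSeparation A B × order A B <ℕ k) ×
    (∀ A B → IsSeparation A B → order A B <ℕ k → (T A B ⊎ T B A) × ¬ (T A B × T B A)) ×
    (∀ A₁ B₁ A₂ B₂ A₃ B₃ → T A₁ B₁ → T A₂ B₂ → T A₃ B₃ →
       Σ V λ v → v ∉ A₁ ∪ A₂ ∪ A₃)

  𝒯F : ℕ → Subset (n G) → Subset (n G) → Subset (n G) → Set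
  𝒯F k F A B = IsSeparation A B × order A B <ℕ k × 2 * k <ℕ ∣ B ∩ F ∣

-- Since α ≥ 2/3, every separation of order at most 3k+1 has exactly one side holding more
-- than α|S| vertices of S, and the other side then holds less than (1−α)|S| ≤ |S|/3 of them:
-- otherwise the separator would be an α-balanced separator for S.  Three such light sides
-- cannot cover S, which gives the tangle axiom.  For (A, B) of order < k, freeness of F,
-- applied to (A ∪ F, B) or (A, B ∪ F), whose orders stay below 3k = |F|, shows that the
-- heavy side with respect to S is exactly the side containing more than 2k vertices of F.

module Submission where

open import Data.Empty using (⊥-elim)
open import Data.Fin using (Fin)
open import Data.Fin.Subset using (Subset; _∈_; _∉_; _⊆_; _∩_; _∪_; ∁; ∣_∣; inside; outside)
open import Data.Fin.Subset.Properties
  using (_∈?_; nonempty?; p⊆q⇒∣p∣≤∣q∣; x∈p∩q⁺; x∈p∩q⁻; x∈p∪q⁺; x∈p∪q⁻; p⊆p∪q; q⊆p∪q;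
         x∉p⇒x∈∁p; x∈∁p⇒x∉p; x∉∁p⇒x∈p; ∩-comm; ∩-distribˡ-∪; ∩-distribʳ-∪)
open import Data.Integer using (+_)
import Data.Integer as ℤ
open import Data.Nat using (ℕ; suc; z≤n; s≤s; _+_; _*_) renaming (_≤_ to _≤ℕ_; _<_ to _<ℕ_)
import Data.Nat.Properties as ℕ
open import Data.Nat.Divisibility using (∣1⇒≡1)
open import Data.Product using (Σ; _×_; _,_; proj₁; proj₂)
open import Data.Rational using (ℚ; 0ℚ; mkℚ; _/_; _≤_; _<_; nonNegative)
  renaming (_+_ to _+ℚ_; _*_ to _*ℚ_)
import Data.Rational.Properties as ℚ
open import Data.Rational.Solver using (module +-*-Solver)
open import Data.Sum using (_⊎_; inj₁; inj₂)
import Data.Sum as Sum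
open import Data.Vec using (_∷_; [])
open import Relation.Binary.PropositionalEquality using (_≡_; refl; sym; trans; cong; cong₂; subst)
open import Relation.Nullary using (¬_; Dec; yes; no)
open import Relation.Nullary.Decidable using (_×-dec_; _⊎-dec_; decidable-stable)

open import Defs renaming (sym to Adj-sym)

open +-*-Solver using (solve; _:+_; _:*_; _:=_; con)

ℕ→ℚ≡mkℚ : ∀ m → ℕ→ℚ m ≡ mkℚ (+ m) 0 (λ (_ , d∣1) → ∣1⇒≡1 d∣1)
ℕ→ℚ≡mkℚ m = ℚ.normalize-coprime _

ℕ→ℚ-+ : ∀ a b → ℕ→ℚ (a + b) ≡ ℕ→ℚ a +ℚ ℕ→ℚ b
ℕ→ℚ-+ a b = sym (trans (cong₂ _+ℚ_ (ℕ→ℚ≡mkℚ a) (ℕ→ℚ≡mkℚ b))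
  (ℚ./-cong {p₁ = + a ℤ.* + 1 ℤ.+ + b ℤ.* + 1} {q₁ = 1}
    (cong₂ ℤ._+_ (*-identityʳ (+ a)) (*-identityʳ (+ b))) refl))
  where open import Data.Integer.Properties using (*-identityʳ)

0≤ℕ→ℚ : ∀ m → 0ℚ ≤ ℕ→ℚ m
0≤ℕ→ℚ m = ℚ.nonNegative⁻¹ (ℕ→ℚ m) {{ℚ.normalize-nonNeg m 1}}

ℕ→ℚ-mono : ∀ {a b} → a ≤ℕ b → ℕ→ℚ a ≤ ℕ→ℚ b
ℕ→ℚ-mono {a} {b} a≤b with ℕ.m≤n⇒∃[o]m+o≡n a≤b
... | c , refl = begin
  ℕ→ℚ a          ≡⟨ sym (ℚ.+-identityʳ (ℕ→ℚ a)) ⟩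
  ℕ→ℚ a +ℚ 0ℚ    ≤⟨ ℚ.+-monoʳ-≤ (ℕ→ℚ a) (0≤ℕ→ℚ c) ⟩
  ℕ→ℚ a +ℚ ℕ→ℚ c ≡⟨ sym (ℕ→ℚ-+ a c) ⟩
  ℕ→ℚ (a + c)    ∎
  where open ℚ.≤-Reasoning

module _ {α : ℚ} (2/3≤α : + 2 / 3 ≤ α) (m : ℕ) where

  0≤α*m : 0ℚ ≤ α *ℚ ℕ→ℚ m
  0≤α*m = begin
    0ℚ                   ≡⟨ sym (ℚ.*-zeroʳ (+ 2 / 3)) ⟩
    (+ 2 / 3) *ℚ 0ℚ      ≤⟨ ℚ.*-monoˡ-≤-nonNeg (+ 2 / 3) (0≤ℕ→ℚ m) ⟩
    (+ 2 / 3) *ℚ ℕ→ℚ m   ≤⟨ ℚ.*-monoʳ-≤-nonNeg (ℕ→ℚ m) {{nonNegative (0≤ℕ→ℚ m)}} 2/3≤α ⟩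
    α *ℚ ℕ→ℚ m           ∎
    where open ℚ.≤-Reasoning

  2m≤3αm : ℕ→ℚ m +ℚ ℕ→ℚ m ≤ α *ℚ ℕ→ℚ m +ℚ α *ℚ ℕ→ℚ m +ℚ α *ℚ ℕ→ℚ m
  2m≤3αm = begin
    ℕ→ℚ m +ℚ ℕ→ℚ m
      ≡⟨ solve 1 (λ x → x :+ x := con (+ 2 / 3) :* x :+ con (+ 2 / 3) :* x :+ con (+ 2 / 3) :* x)
               refl (ℕ→ℚ m) ⟩
    ⅔m +ℚ ⅔m +ℚ ⅔m
      ≤⟨ ℚ.+-mono-≤ (ℚ.+-mono-≤ ⅔m≤αm ⅔m≤αm) ⅔m≤αm ⟩
    α *ℚ ℕ→ℚ m +ℚ α *ℚ ℕ→ℚ m +ℚ α *ℚ ℕ→ℚ m ∎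
    where
      open ℚ.≤-Reasoning
      ⅔m : ℚ
      ⅔m = (+ 2 / 3) *ℚ ℕ→ℚ m
      ⅔m≤αm : ⅔m ≤ α *ℚ ℕ→ℚ m
      ⅔m≤αm = ℚ.*-monoʳ-≤-nonNeg (ℕ→ℚ m) {{nonNegative (0≤ℕ→ℚ m)}} 2/3≤α

module _ {β s : ℚ} (0≤β : 0ℚ ≤ β) (2s≤3β : s +ℚ s ≤ β +ℚ β +ℚ β) where

  β<x⇒x+β≮s : ∀ {x} → β < x → ¬ (x +ℚ β < s)
  β<x⇒x+β≮s {x} β<x x+β<s = ℚ.<-irrefl refl (begin-strict
    β +ℚ β +ℚ β           ≡⟨ sym (ℚ.+-identityˡ _) ⟩
    0ℚ +ℚ (β +ℚ β +ℚ β)   ≤⟨ ℚ.+-monoˡ-≤ (β +ℚ β +ℚ β) 0≤β ⟩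
    β +ℚ (β +ℚ β +ℚ β)    ≡⟨ solve 1 (λ b → b :+ (b :+ b :+ b) := (b :+ b) :+ (b :+ b)) refl β ⟩
    (β +ℚ β) +ℚ (β +ℚ β)  <⟨ ℚ.+-mono-< 2β<s 2β<s ⟩
    s +ℚ s                ≤⟨ 2s≤3β ⟩
    β +ℚ β +ℚ β           ∎)
    where
      open ℚ.≤-Reasoning
      2β<s : β +ℚ β < s
      2β<s = ℚ.<-trans (ℚ.+-monoˡ-< β β<x) x+β<s

  +β<s³⇒s≰x+y+z : ∀ {x y z} → x +ℚ β < s → y +ℚ β < s → z +ℚ β < s → ¬ (s ≤ x +ℚ y +ℚ z)
  +β<s³⇒s≰x+y+z {x} {y} {z} x+β<s y+β<s z+β<s s≤x+y+z = ℚ.<-irrefl refl (begin-strict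
    s +ℚ s +ℚ s
      ≡⟨ solve 1 (λ a → a :+ a :+ a := a :+ (a :+ a)) refl s ⟩
    s +ℚ (s +ℚ s)
      ≤⟨ ℚ.+-mono-≤ s≤x+y+z 2s≤3β ⟩
    (x +ℚ y +ℚ z) +ℚ (β +ℚ β +ℚ β)
      ≡⟨ solve 4 (λ x y z b → (x :+ y :+ z) :+ (b :+ b :+ b) := (x :+ b) :+ (y :+ b) :+ (z :+ b))
               refl x y z β ⟩
    (x +ℚ β) +ℚ (y +ℚ β) +ℚ (z +ℚ β)
      <⟨ ℚ.+-mono-< (ℚ.+-mono-< x+β<s y+β<s) z+β<s ⟩
    s +ℚ s +ℚ s ∎)
    where open ℚ.≤-Reasoning

∣p∪q∣≤∣p∣+∣q∣ : ∀ {m} (p q : Subset m) → ∣ p ∪ q ∣ ≤ℕ ∣ p ∣ + ∣ q ∣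
∣p∪q∣≤∣p∣+∣q∣ [] [] = z≤n
∣p∪q∣≤∣p∣+∣q∣ (outside ∷ p) (outside ∷ q) = ∣p∪q∣≤∣p∣+∣q∣ p q
∣p∪q∣≤∣p∣+∣q∣ (outside ∷ p) (inside ∷ q) =
  ℕ.≤-trans (s≤s (∣p∪q∣≤∣p∣+∣q∣ p q)) (ℕ.≤-reflexive (sym (ℕ.+-suc _ _)))
∣p∪q∣≤∣p∣+∣q∣ (inside ∷ p) (outside ∷ q) = s≤s (∣p∪q∣≤∣p∣+∣q∣ p q)
∣p∪q∣≤∣p∣+∣q∣ (inside ∷ p) (inside ∷ q) =
  s≤s (ℕ.≤-trans (ℕ.m≤n⇒m≤1+n (∣p∪q∣≤∣p∣+∣q∣ p q)) (ℕ.≤-reflexive (sym (ℕ.+-suc _ _))))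

∣p∩q∣+∣p∩∁q∣≡∣p∣ : ∀ {m} (p q : Subset m) → ∣ p ∩ q ∣ + ∣ p ∩ ∁ q ∣ ≡ ∣ p ∣
∣p∩q∣+∣p∩∁q∣≡∣p∣ [] [] = refl
∣p∩q∣+∣p∩∁q∣≡∣p∣ (outside ∷ p) (_ ∷ q) = ∣p∩q∣+∣p∩∁q∣≡∣p∣ p q
∣p∩q∣+∣p∩∁q∣≡∣p∣ (inside ∷ p) (outside ∷ q) = trans (ℕ.+-suc _ _) (cong suc (∣p∩q∣+∣p∩∁q∣≡∣p∣ p q))
∣p∩q∣+∣p∩∁q∣≡∣p∣ (inside ∷ p) (inside ∷ q) = cong suc (∣p∩q∣+∣p∩∁q∣≡∣p∣ p q)

module _ {m : ℕ} where

  ∣p∩q∣≡∣q∩p∣ : (p q : Subset m) → ∣ p ∩ q ∣ ≡ ∣ q ∩ p ∣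
  ∣p∩q∣≡∣q∩p∣ p q = cong ∣_∣ (∩-comm p q)

  p⊆q⇒∣p∣≤∣p∩q∣ : {p q : Subset m} → p ⊆ q → ∣ p ∣ ≤ℕ ∣ p ∩ q ∣
  p⊆q⇒∣p∣≤∣p∩q∣ p⊆q = p⊆q⇒∣p∣≤∣q∣ (λ x∈p → x∈p∩q⁺ (x∈p , p⊆q x∈p))

  ∣p∩[q∪r]∣≤∣p∩q∣+∣p∩r∣ : (p q r : Subset m) → ∣ p ∩ (q ∪ r) ∣ ≤ℕ ∣ p ∩ q ∣ + ∣ p ∩ r ∣
  ∣p∩[q∪r]∣≤∣p∩q∣+∣p∩r∣ p q r =
    subst (_≤ℕ ∣ p ∩ q ∣ + ∣ p ∩ r ∣) (cong ∣_∣ (sym (∩-distribˡ-∪ p q r))) (∣p∪q∣≤∣p∣+∣q∣ (p ∩ q) (p ∩ r))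

  ⊆∪³⇒∣p∣≤∑∣p∩qᵢ∣ : {p q₁ q₂ q₃ : Subset m} → p ⊆ q₁ ∪ q₂ ∪ q₃ →
                     ∣ p ∣ ≤ℕ ∣ p ∩ q₁ ∣ + ∣ p ∩ q₂ ∣ + ∣ p ∩ q₃ ∣
  ⊆∪³⇒∣p∣≤∑∣p∩qᵢ∣ {p} {q₁} {q₂} {q₃} p⊆q = begin
    ∣ p ∣                                    ≤⟨ p⊆q⇒∣p∣≤∣p∩q∣ p⊆q ⟩
    ∣ p ∩ (q₁ ∪ q₂ ∪ q₃) ∣                   ≤⟨ ∣p∩[q∪r]∣≤∣p∩q∣+∣p∩r∣ p q₁ _ ⟩
    ∣ p ∩ q₁ ∣ + ∣ p ∩ (q₂ ∪ q₃) ∣           ≤⟨ ℕ.+-monoʳ-≤ ∣ p ∩ q₁ ∣ (∣p∩[q∪r]∣≤∣p∩q∣+∣p∩r∣ p q₂ q₃) ⟩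
    ∣ p ∩ q₁ ∣ + (∣ p ∩ q₂ ∣ + ∣ p ∩ q₃ ∣)   ≡⟨ sym (ℕ.+-assoc ∣ p ∩ q₁ ∣ _ _) ⟩
    ∣ p ∩ q₁ ∣ + ∣ p ∩ q₂ ∣ + ∣ p ∩ q₃ ∣     ∎
    where open ℕ.≤-Reasoning

  ∣[p∪r]∩q∣≤∣p∩q∣+∣r∩q∣ : (p q r : Subset m) → ∣ (p ∪ r) ∩ q ∣ ≤ℕ ∣ p ∩ q ∣ + ∣ r ∩ q ∣
  ∣[p∪r]∩q∣≤∣p∩q∣+∣r∩q∣ p q r =
    subst (_≤ℕ ∣ p ∩ q ∣ + ∣ r ∩ q ∣) (cong ∣_∣ (sym (∩-distribʳ-∪ q p r))) (∣p∪q∣≤∣p∣+∣q∣ (p ∩ q) (r ∩ q))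

  ∣p∩[q∪r]∣≤∣p∩q∣+∣r∩∁q∣ : (p q r : Subset m) → ∣ p ∩ (q ∪ r) ∣ ≤ℕ ∣ p ∩ q ∣ + ∣ r ∩ ∁ q ∣
  ∣p∩[q∪r]∣≤∣p∩q∣+∣r∩∁q∣ p q r = ℕ.≤-trans (p⊆q⇒∣p∣≤∣q∣ ⊆-split) (∣p∪q∣≤∣p∣+∣q∣ (p ∩ q) (r ∩ ∁ q))
    where
      ⊆-split : p ∩ (q ∪ r) ⊆ p ∩ q ∪ r ∩ ∁ q
      ⊆-split {x} x∈ with x∈p∩q⁻ p (q ∪ r) x∈ | x ∈? q
      ... | x∈p , _    | yes x∈q = x∈p∪q⁺ (inj₁ (x∈p∩q⁺ (x∈p , x∈q)))
      ... | _ , x∈q∪r  | no x∉q  =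
        x∈p∪q⁺ (inj₂ (x∈p∩q⁺ (Sum.[ (λ x∈q → ⊥-elim (x∉q x∈q)) , (λ x∈r → x∈r) ] (x∈p∪q⁻ q r x∈q∪r)
                             , x∉p⇒x∈∁p x∉q)))

  ¬⊆⇒∃∉ : (p : Subset m) → ¬ (∀ x → x ∈ p) → Σ (Fin m) λ x → x ∉ p
  ¬⊆⇒∃∉ p ¬all with nonempty? (∁ p)
  ... | yes (x , x∈∁p) = x , x∈∁p⇒x∉p x∈∁p
  ... | no ∁p-empty    = ⊥-elim (¬all λ x → x∉∁p⇒x∈p λ x∈∁p → ∁p-empty (x , x∈∁p))

module _ (G : Graph) where

  IsSeparation-swap : ∀ {A B} → IsSeparation G A B → IsSeparation G B A
  IsSeparation-swap (cover , no-edge) =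
    (λ v → Sum.swap (cover v)) ,
    λ u v u∈B u∉A v∈A v∉B u~v → no-edge v u v∈A v∉B u∈B u∉A (Adj-sym G u~v)

  IsSeparation-∪ʳ : ∀ {A B} Z → IsSeparation G A B → IsSeparation G A (B ∪ Z)
  IsSeparation-∪ʳ {A} {B} Z (cover , no-edge) =
    (λ v → Sum.map₂ (λ v∈B → p⊆p∪q Z v∈B) (cover v)) ,
    λ u v u∈A u∉B∪Z v∈B∪Z v∉A → no-edge u v u∈A (λ u∈B → u∉B∪Z (p⊆p∪q Z u∈B)) (∈B v v∉A) v∉A
    where
      ∈B : ∀ v → v ∉ A → v ∈ B
      ∈B v v∉A = Sum.[ (λ v∈A → ⊥-elim (v∉A v∈A)) , (λ v∈B → v∈B) ] (cover v)

  IsSeparation-∪ˡ : ∀ {A B} Z → IsSeparation G A B → IsSeparation G (A ∪ Z) B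
  IsSeparation-∪ˡ Z sep = IsSeparation-swap (IsSeparation-∪ʳ Z (IsSeparation-swap sep))

  Reach-source∉ : ∀ {X u v} → Reach G X u v → u ∉ X
  Reach-source∉ (here u∉X)     = u∉X
  Reach-source∉ (step u∉X _ _) = u∉X

  Reach-∉ : ∀ {A B X} → IsSeparation G A B → A ∩ B ⊆ X → ∀ {u v} → u ∉ A → Reach G X u v → v ∉ A
  Reach-∉ sep A∩B⊆X u∉A (here _) = u∉A
  Reach-∉ {A} {B} sep A∩B⊆X {u} u∉A (step {v = w} _ u~w w⇝v) = Reach-∉ sep A∩B⊆X w∉A w⇝v
    where
      w∉A : w ∉ A
      w∉A w∈A = Sum.[ u∉A , u∉B ] (proj₁ sep u)
        where
          w∉B : w ∉ B
          w∉B w∈B = Reach-source∉ w⇝v (A∩B⊆X (x∈p∩q⁺ (w∈A , w∈B)))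
          u∉B : u ∉ B
          u∉B u∈B = proj₂ sep w u w∈A w∉B u∈B u∉A (Adj-sym G u~w)

module _ {α : ℚ} (2/3≤α : + 2 / 3 ≤ α) (G : Graph) (S : Subset (n G)) where

  Heavy : Subset (n G) → Set
  Heavy Y = α *ℚ ℕ→ℚ ∣ S ∣ < ℕ→ℚ ∣ S ∩ Y ∣

  -- |S ∩ Y| < (1 − α)|S|, stated without subtraction.
  Light : Subset (n G) → Set
  Light Y = ℕ→ℚ ∣ S ∩ Y ∣ +ℚ α *ℚ ℕ→ℚ ∣ S ∣ < ℕ→ℚ ∣ S ∣

  ¬Heavy×Light : ∀ {Y} → Heavy Y → ¬ Light Y
  ¬Heavy×Light = β<x⇒x+β≮s (0≤α*m 2/3≤α ∣ S ∣) (2m≤3αm 2/3≤α ∣ S ∣)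

  ¬Light³-cover : ∀ {A₁ A₂ A₃} → Light A₁ → Light A₂ → Light A₃ → ¬ (S ⊆ A₁ ∪ A₂ ∪ A₃)
  ¬Light³-cover {A₁} {A₂} {A₃} l₁ l₂ l₃ S⊆A =
    +β<s³⇒s≰x+y+z (0≤α*m 2/3≤α ∣ S ∣) (2m≤3αm 2/3≤α ∣ S ∣)
      {ℕ→ℚ ∣ S ∩ A₁ ∣} {ℕ→ℚ ∣ S ∩ A₂ ∣} {ℕ→ℚ ∣ S ∩ A₃ ∣} l₁ l₂ l₃ (begin
      ℕ→ℚ ∣ S ∣                                                ≤⟨ ℕ→ℚ-mono (⊆∪³⇒∣p∣≤∑∣p∩qᵢ∣ S⊆A) ⟩
      ℕ→ℚ (∣ S ∩ A₁ ∣ + ∣ S ∩ A₂ ∣ + ∣ S ∩ A₃ ∣)               ≡⟨ ℕ→ℚ-+ (∣ S ∩ A₁ ∣ + ∣ S ∩ A₂ ∣) _ ⟩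
      ℕ→ℚ (∣ S ∩ A₁ ∣ + ∣ S ∩ A₂ ∣) +ℚ ℕ→ℚ ∣ S ∩ A₃ ∣          ≡⟨ cong (_+ℚ ℕ→ℚ ∣ S ∩ A₃ ∣) (ℕ→ℚ-+ ∣ S ∩ A₁ ∣ _) ⟩
      ℕ→ℚ ∣ S ∩ A₁ ∣ +ℚ ℕ→ℚ ∣ S ∩ A₂ ∣ +ℚ ℕ→ℚ ∣ S ∩ A₃ ∣      ∎)
    where open ℚ.≤-Reasoning

  heavy×light? : ∀ B A → Dec (Heavy B × Light A)
  heavy×light? B A = (_ ℚ.<? _) ×-dec (_ ℚ.<? _)

  heavy-outside⇒heavy×light : ∀ {A B D} → IsSeparation G A B → (∀ {v} → v ∈ D → v ∉ A) →
    α *ℚ ℕ→ℚ ∣ S ∣ < ℕ→ℚ ∣ D ∩ S ∣ → Heavy B × Light A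
  heavy-outside⇒heavy×light {A} {B} {D} (cover , _) D-outside-A heavyD = heavyB , lightA
    where
      D∩S⊆S∩∁A : D ∩ S ⊆ S ∩ ∁ A
      D∩S⊆S∩∁A x∈D∩S = let x∈D , x∈S = x∈p∩q⁻ D S x∈D∩S in x∈p∩q⁺ (x∈S , x∉p⇒x∈∁p (D-outside-A x∈D))
      D∩S⊆S∩B : D ∩ S ⊆ S ∩ B
      D∩S⊆S∩B {x} x∈D∩S = let x∈D , x∈S = x∈p∩q⁻ D S x∈D∩S in
        x∈p∩q⁺ (x∈S , Sum.[ (λ x∈A → ⊥-elim (D-outside-A x∈D x∈A)) , (λ x∈B → x∈B) ] (cover x))
      heavyB : Heavy B
      heavyB = ℚ.<-≤-trans heavyD (ℕ→ℚ-mono (p⊆q⇒∣p∣≤∣q∣ D∩S⊆S∩B))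
      lightA : Light A
      lightA = begin-strict
        ℕ→ℚ ∣ S ∩ A ∣ +ℚ α *ℚ ℕ→ℚ ∣ S ∣    <⟨ ℚ.+-monoʳ-< (ℕ→ℚ ∣ S ∩ A ∣) heavyD ⟩
        ℕ→ℚ ∣ S ∩ A ∣ +ℚ ℕ→ℚ ∣ D ∩ S ∣     ≡⟨ sym (ℕ→ℚ-+ ∣ S ∩ A ∣ _) ⟩
        ℕ→ℚ (∣ S ∩ A ∣ + ∣ D ∩ S ∣)        ≤⟨ ℕ→ℚ-mono (ℕ.+-monoʳ-≤ ∣ S ∩ A ∣ (p⊆q⇒∣p∣≤∣q∣ D∩S⊆S∩∁A)) ⟩
        ℕ→ℚ (∣ S ∩ A ∣ + ∣ S ∩ ∁ A ∣)      ≡⟨ cong ℕ→ℚ (∣p∩q∣+∣p∩∁q∣≡∣p∣ S A) ⟩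
        ℕ→ℚ ∣ S ∣                          ∎
        where open ℚ.≤-Reasoning

  heavy-component⇒heavy×light : ∀ {A B C} → IsSeparation G A B → IsComponent G (A ∩ B) C →
    α *ℚ ℕ→ℚ ∣ S ∣ < ℕ→ℚ ∣ C ∩ S ∣ → (Heavy B × Light A) ⊎ (Heavy A × Light B)
  heavy-component⇒heavy×light {A} {B} sep (u , u∉A∩B , C≡reach) heavyC with u ∈? A
  ... | no u∉A = inj₁ (heavy-outside⇒heavy×light sep
          (λ v∈C → Reach-∉ G sep (λ x∈ → x∈) u∉A (proj₁ (C≡reach _) v∈C)) heavyC)
  ... | yes u∈A = inj₂ (heavy-outside⇒heavy×light (IsSeparation-swap G sep)
          (λ v∈C → Reach-∉ G (IsSeparation-swap G sep) B∩A⊆A∩B u∉B (proj₁ (C≡reach _) v∈C)) heavyC)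
    where
      u∉B : u ∉ B
      u∉B u∈B = u∉A∩B (x∈p∩q⁺ (u∈A , u∈B))
      B∩A⊆A∩B : B ∩ A ⊆ A ∩ B
      B∩A⊆A∩B {x} = subst (x ∈_) (∩-comm B A)

  module _ {q : ℕ} (wl : WellLinked G q α S) where

    heavy×light-dichotomy : ∀ {A B} → IsSeparation G A B → order G A B ≤ℕ q →
      (Heavy B × Light A) ⊎ (Heavy A × Light B)
    heavy×light-dichotomy {A} {B} sep ord =
      decidable-stable (heavy×light? B A ⊎-dec heavy×light? A B) λ ¬hl →
        wl (A ∩ B , ord , balanced ¬hl)
      where
        balanced : ¬ ((Heavy B × Light A) ⊎ (Heavy A × Light B)) → Balanced G α S (A ∩ B)
        balanced ¬hl C comp = decidable-stable (ℕ→ℚ ∣ C ∩ S ∣ ℚ.≤? α *ℚ ℕ→ℚ ∣ S ∣) λ ¬lightC →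
          ¬hl (heavy-component⇒heavy×light {C = C} sep comp (ℚ.≰⇒> ¬lightC))

    ¬Heavy×Heavy : ∀ {A B} → IsSeparation G A B → order G A B ≤ℕ q → Heavy A → ¬ Heavy B
    ¬Heavy×Heavy {A} {B} sep ord heavyA heavyB =
      Sum.[ (λ (_ , lightA) → ¬Heavy×Light {A} heavyA lightA)
          , (λ (_ , lightB) → ¬Heavy×Light {B} heavyB lightB)
          ] (heavy×light-dichotomy sep ord)

    Heavyʳ⊎Heavyˡ : ∀ {A B} → IsSeparation G A B → order G A B ≤ℕ q → Heavy B ⊎ Heavy A
    Heavyʳ⊎Heavyˡ sep ord = Sum.map proj₁ proj₁ (heavy×light-dichotomy sep ord)

    Heavyʳ⇒Lightˡ : ∀ {A B} → IsSeparation G A B → order G A B ≤ℕ q → Heavy B → Light A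
    Heavyʳ⇒Lightˡ sep ord heavyB =
      Sum.[ proj₂ , (λ (heavyA , _) → ⊥-elim (¬Heavy×Heavy sep ord heavyA heavyB)) ]
        (heavy×light-dichotomy sep ord)

  module _ {F : Subset (n G)} (free : Free G α S F) where

    Free⇒Heavyˡ : ∀ {A B} → IsSeparation G A B → order G A B <ℕ ∣ F ∣ → F ⊆ A → Heavy A
    Free⇒Heavyˡ {A} {B} sep ord F⊆A =
      subst (λ c → α *ℚ ℕ→ℚ ∣ S ∣ < ℕ→ℚ c) (∣p∩q∣≡∣q∩p∣ A S) (proj₁ (free A B sep ord) F⊆A)

    Free⇒Heavyʳ : ∀ {A B} → IsSeparation G A B → order G A B <ℕ ∣ F ∣ → F ⊆ B → Heavy B
    Free⇒Heavyʳ {A} {B} sep ord F⊆B =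
      subst (λ c → α *ℚ ℕ→ℚ ∣ S ∣ < ℕ→ℚ c) (∣p∩q∣≡∣q∩p∣ B S) (proj₂ (free A B sep ord) F⊆B)

  module _ {k : ℕ} (wl : WellLinked G (3 * k + 1) α S)
           {F : Subset (n G)} (free : Free G α S F) (∣F∣≡3k : ∣ F ∣ ≡ 3 * k) where

    <∣F∣⇒≤3k+1 : ∀ {o} → o <ℕ ∣ F ∣ → o ≤ℕ 3 * k + 1
    <∣F∣⇒≤3k+1 o<∣F∣ = ℕ.≤-trans (ℕ.<⇒≤ (subst (_ <ℕ_) ∣F∣≡3k o<∣F∣)) (ℕ.m≤m+n (3 * k) 1)

    <k⇒≤3k+1 : ∀ {o} → o <ℕ k → o ≤ℕ 3 * k + 1
    <k⇒≤3k+1 o<k = ℕ.≤-trans (ℕ.<⇒≤ o<k) (ℕ.≤-trans (ℕ.m≤m+n k (2 * k)) (ℕ.m≤m+n (3 * k) 1))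

    𝒯F⊆𝒯 : ∀ A B → 𝒯F G k F A B → 𝒯 G (3 * k + 1) α S A B
    𝒯F⊆𝒯 A B (sep , ord , 2k<∣B∩F∣) =
      sep , <k⇒≤3k+1 ord ,
      Sum.fromInj₁ (λ heavyA → ⊥-elim (¬heavyA heavyA)) (Heavyʳ⊎Heavyˡ wl sep (<k⇒≤3k+1 ord))
      where
        sep′ : IsSeparation G A (B ∪ F)
        sep′ = IsSeparation-∪ʳ G F sep
        k≤∣F∩B∣ : k ≤ℕ ∣ F ∩ B ∣
        k≤∣F∩B∣ = ℕ.≤-trans (ℕ.m≤m+n k _) (ℕ.<⇒≤ (subst (2 * k <ℕ_) (∣p∩q∣≡∣q∩p∣ B F) 2k<∣B∩F∣))
        ord′ : order G A (B ∪ F) <ℕ ∣ F ∣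
        ord′ = begin-strict
          ∣ A ∩ (B ∪ F) ∣          ≤⟨ ∣p∩[q∪r]∣≤∣p∩q∣+∣r∩∁q∣ A B F ⟩
          ∣ A ∩ B ∣ + ∣ F ∩ ∁ B ∣  <⟨ ℕ.+-monoˡ-< ∣ F ∩ ∁ B ∣ ord ⟩
          k + ∣ F ∩ ∁ B ∣          ≤⟨ ℕ.+-monoˡ-≤ ∣ F ∩ ∁ B ∣ k≤∣F∩B∣ ⟩
          ∣ F ∩ B ∣ + ∣ F ∩ ∁ B ∣  ≡⟨ ∣p∩q∣+∣p∩∁q∣≡∣p∣ F B ⟩
          ∣ F ∣                    ∎
          where open ℕ.≤-Reasoning
        ¬heavyA : ¬ Heavy A
        ¬heavyA heavyA =
          ¬Heavy×Heavy wl sep′ (<∣F∣⇒≤3k+1 ord′) heavyA (Free⇒Heavyʳ free sep′ ord′ (q⊆p∪q B F))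

    Heavy⇒𝒯F : ∀ {A B} → IsSeparation G A B → order G A B <ℕ k → Heavy B → 𝒯F G k F A B
    Heavy⇒𝒯F {A} {B} sep ord heavyB = sep , ord , decidable-stable (2 * k ℕ.<? ∣ B ∩ F ∣) ¬¬2k<∣B∩F∣
      where
        sep′ : IsSeparation G (A ∪ F) B
        sep′ = IsSeparation-∪ˡ G F sep
        ¬¬2k<∣B∩F∣ : ¬ ¬ (2 * k <ℕ ∣ B ∩ F ∣)
        ¬¬2k<∣B∩F∣ 2k≮∣B∩F∣ =
          ¬Heavy×Heavy wl sep′ (<∣F∣⇒≤3k+1 ord′) (Free⇒Heavyˡ free sep′ ord′ (q⊆p∪q A F)) heavyB
          where
            ∣F∩B∣≤2k : ∣ F ∩ B ∣ ≤ℕ 2 * k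
            ∣F∩B∣≤2k = subst (_≤ℕ 2 * k) (∣p∩q∣≡∣q∩p∣ B F) (ℕ.≮⇒≥ 2k≮∣B∩F∣)
            ord′ : order G (A ∪ F) B <ℕ ∣ F ∣
            ord′ = begin-strict
              ∣ (A ∪ F) ∩ B ∣        ≤⟨ ∣[p∪r]∩q∣≤∣p∩q∣+∣r∩q∣ A B F ⟩
              ∣ A ∩ B ∣ + ∣ F ∩ B ∣  <⟨ ℕ.+-mono-<-≤ ord ∣F∩B∣≤2k ⟩
              k + 2 * k              ≡⟨ sym ∣F∣≡3k ⟩
              ∣ F ∣                  ∎
              where open ℕ.≤-Reasoning

    𝒯F⇒Heavy : ∀ {A B} → 𝒯F G k F A B → Heavy B
    𝒯F⇒Heavy {A} {B} t = proj₂ (proj₂ (𝒯F⊆𝒯 A B t))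

    𝒯F⇒Light : ∀ {A B} → 𝒯F G k F A B → Light A
    𝒯F⇒Light t@(sep , ord , _) = Heavyʳ⇒Lightˡ wl sep (<k⇒≤3k+1 ord) (𝒯F⇒Heavy t)

    𝒯F-total : ∀ {A B} → IsSeparation G A B → order G A B <ℕ k → 𝒯F G k F A B ⊎ 𝒯F G k F B A
    𝒯F-total {A} {B} sep ord =
      Sum.map (Heavy⇒𝒯F sep ord) (Heavy⇒𝒯F (IsSeparation-swap G sep) (subst (_<ℕ k) (∣p∩q∣≡∣q∩p∣ A B) ord))
        (Heavyʳ⊎Heavyˡ wl sep (<k⇒≤3k+1 ord))

    𝒯F-asym : ∀ {A B} → ¬ (𝒯F G k F A B × 𝒯F G k F B A)
    𝒯F-asym (tAB@(sep , ord , _) , tBA) =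
      ¬Heavy×Heavy wl sep (<k⇒≤3k+1 ord) (𝒯F⇒Heavy tBA) (𝒯F⇒Heavy tAB)

    𝒯F-isTangle : IsTangle G k (𝒯F G k F)
    𝒯F-isTangle =
      (λ _ _ (sep , ord , _) → sep , ord) ,
      (λ _ _ sep ord → 𝒯F-total sep ord , 𝒯F-asym) ,
      λ A₁ _ A₂ _ A₃ _ t₁ t₂ t₃ → ¬⊆⇒∃∉ (A₁ ∪ A₂ ∪ A₃) λ covers →
        ¬Light³-cover {A₁} {A₂} {A₃} (𝒯F⇒Light t₁) (𝒯F⇒Light t₂) (𝒯F⇒Light t₃) (λ {v} _ → covers v)

lemma3p7 : (α : ℚ) → (+ 2 / 3) ≤ α → α < (+ 1 / 1) →
    (k : ℕ) → 1 ≤ℕ k → (G : Graph) → (S : Subset (n G)) →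
    WellLinked G (3 * k + 1) α S →
    (F : Subset (n G)) → Free G α S F → ∣ F ∣ ≡ 3 * k →
    IsTangle G k (𝒯F G k F) × (∀ A B → 𝒯F G k F A B → 𝒯 G (3 * k + 1) α S A B)
lemma3p7 _ 2/3≤α _ _ _ G S wl _ free ∣F∣≡3k =
  𝒯F-isTangle 2/3≤α G S wl free ∣F∣≡3k , 𝒯F⊆𝒯 2/3≤α G S wl free ∣F∣≡3k
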